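{- Let $D$ be a dendriform algebra over a field $k$ of characteristic zero and $\overline D=D\oplus k\mathbf 1$ its unital augmentation. Let $a,b,c\in D$, $M=\begin{pmatrix} c& b\\ a&0\end{pmatrix}\in\mathcal M_2(D)$, and let $Z\in\overline{\mathcal M_2(D)}[[\lambda]]$ be the solution of $Z=\mathbf 1_2+\lambda\, Z\succ M$ (so $Z=\exp^*(\Omega')$ with $\Omega'=\log^* Z$). Let $X\in\overline D[[\lambda]]$ be the solution of $X=\mathbf 1+\lambda\, X\succ c+\lambda^2(X\succ b)\succ a$. Then the first row of $Z$ is $(X,\ \lambda\, X\succ b)$; in particular $X=(1,0)\,Z\,(1,0)^{t}=Z_{11}$.
   Context: A dendriform algebra over $k$ is a $k$-vector space $D$ with bilinear operations $\prec,\succ$ such that $(a\prec b)\prec c=a\prec(b\prec c+b\succ c)$, $(a\succ b)\prec c=a\succ(b\prec c)$, $a\succ(b\succ c)=(a\prec b+a\succ b)\succ c$; $a*b:=a\prec b+a\succ b$ is associative. The augmentation $\overline D=D\oplus k\mathbf 1$ is defined by $a\prec\mathbf 1=a=\mathbf 1\succ a$, $\mathbf 1\prec a=0=a\succ\mathbf 1$ for $a\in D$ ($\mathbf 1\prec\mathbf 1$, $\mathbf 1\succ\mathbf 1$ undefined). $\mathcal M_2(D)$ is a dendriform algebra with $(P\prec Q)_{ij}=\sum_k P_{ik}\prec Q_{kj}$, $(P\succ Q)_{ij}=\sum_k P_{ik}\succ Q_{kj}$; its augmentation has unit $\mathbf 1_2=\mathrm{diag}(\mathbf 1,\mathbf 1)$.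 Operations extend $\lambda$-bilinearly to formal power series; $\exp^*$ and $\log^*$ are the exponential and logarithm series for the associative product $*$. -}

module Defs where

open import Level using (Level; _⊔_) renaming (suc to lsuc)
open import Algebra.Bundles using (CommutativeRing)
open import Algebra.Module.Bundles using (Module)
open import Data.Nat using (ℕ; zero; suc)
open import Data.Fin using (Fin; zero; suc)
open import Data.Product using (_×_; Σ; _,_)
open import Relation.Nullary using (¬_)

record Field (c ℓ : Level) : Set (lsuc (c ⊔ ℓ)) where
  field
    commutativeRing : CommutativeRing c ℓ
  open CommutativeRing commutativeRing public
  field
    0≉1     : ¬ (0# ≈ 1#)
    inverse : ∀ x → ¬ (x ≈ 0#) → Σ Carrier (λ y → x * y ≈ 1#)

  fromℕ : ℕ → Carrier
  fromℕ zero    = 0#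
  fromℕ (suc n) = 1# + fromℕ n

CharacteristicZero : ∀ {c ℓ} → Field c ℓ → Set ℓ
CharacteristicZero F = ∀ n → ¬ (fromℕ (suc n) ≈ 0#)
  where open Field F

record Dendriform {c ℓ} (k : Field c ℓ) (m ℓm : Level)
       : Set (c ⊔ ℓ ⊔ lsuc (m ⊔ ℓm)) where
  open Field k using (commutativeRing) renaming (Carrier to K)
  field
    vectorSpace : Module commutativeRing m ℓm
  open Module vectorSpace public
  infixl 7 _≺_ _≻_
  infixl 6 _∗_
  field
    _≺_ _≻_ : Carrierᴹ → Carrierᴹ → Carrierᴹ
    ≺-cong : ∀ {x x' y y'} → x ≈ᴹ x' → y ≈ᴹ y' → (x ≺ y) ≈ᴹ (x' ≺ y')
    ≻-cong : ∀ {x x' y y'} → x ≈ᴹ x' → y ≈ᴹ y' → (x ≻ y) ≈ᴹ (x' ≻ y')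
    ≺-distribʳ : ∀ x y z → ((x +ᴹ y) ≺ z) ≈ᴹ ((x ≺ z) +ᴹ (y ≺ z))
    ≺-distribˡ : ∀ x y z → (x ≺ (y +ᴹ z)) ≈ᴹ ((x ≺ y) +ᴹ (x ≺ z))
    ≻-distribʳ : ∀ x y z → ((x +ᴹ y) ≻ z) ≈ᴹ ((x ≻ z) +ᴹ (y ≻ z))
    ≻-distribˡ : ∀ x y z → (x ≻ (y +ᴹ z)) ≈ᴹ ((x ≻ y) +ᴹ (x ≻ z))
    ≺-scalarˡ : ∀ (α : K) x y → ((α *ₗ x) ≺ y) ≈ᴹ (α *ₗ (x ≺ y))
    ≺-scalarʳ : ∀ (α : K) x y → (x ≺ (α *ₗ y)) ≈ᴹ (α *ₗ (x ≺ y))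
    ≻-scalarˡ : ∀ (α : K) x y → ((α *ₗ x) ≻ y) ≈ᴹ (α *ₗ (x ≻ y))
    ≻-scalarʳ : ∀ (α : K) x y → (x ≻ (α *ₗ y)) ≈ᴹ (α *ₗ (x ≻ y))
    dend₁ : ∀ a b c → ((a ≺ b) ≺ c) ≈ᴹ (a ≺ ((b ≺ c) +ᴹ (b ≻ c)))
    dend₂ : ∀ a b c → ((a ≻ b) ≺ c) ≈ᴹ (a ≻ (b ≺ c))
    dend₃ : ∀ a b c → (a ≻ (b ≻ c)) ≈ᴹ (((a ≺ b) +ᴹ (a ≻ b)) ≻ c)

  _∗_ : Carrierᴹ → Carrierᴹ → Carrierᴹ
  x ∗ y = (x ≺ y) +ᴹ (x ≻ y)

module Aug {c ℓ m ℓm} {k : Field c ℓ} (D : Dendriform k m ℓm) where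
  open Field k using (_≈_; _+_; 0#; 1#) renaming (Carrier to K)
  open Dendriform D using (Carrierᴹ; _≈ᴹ_; _+ᴹ_; _*ₗ_; 0ᴹ; _≻_)

  record D̄ : Set (c ⊔ m) where
    constructor _·𝟏+_
    field
      scal : K
      vec  : Carrierᴹ
  open D̄ public

  infix 4 _≈̄_
  _≈̄_ : D̄ → D̄ → Set (ℓ ⊔ ℓm)
  x ≈̄ y = (scal x ≈ scal y) × (vec x ≈ᴹ vec y)

  _+̄_ : D̄ → D̄ → D̄
  x +̄ y = (scal x + scal y) ·𝟏+ (vec x +ᴹ vec y)

  𝟏 0̄ : D̄
  𝟏 = 1# ·𝟏+ 0ᴹ
  0̄ = 0# ·𝟏+ 0ᴹ

  ι : Carrierᴹ → D̄
  ι d = 0# ·𝟏+ d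

  -- the bilinear extension of ≻ to D̄ × D, with 1 ≻ a = a
  -- (all products occurring in the statement are of this form; they
  --  never involve the undefined products 1 ≺ 1, 1 ≻ 1)
  _≻̄_ : D̄ → Carrierᴹ → Carrierᴹ
  x ≻̄ d = (scal x *ₗ d) +ᴹ (vec x ≻ d)

  Mat₂ : ∀ {a} → Set a → Set a
  Mat₂ A = Fin 2 → Fin 2 → A

  mat : Carrierᴹ → Carrierᴹ → Carrierᴹ → Carrierᴹ → Mat₂ Carrierᴹ
  mat x y z w zero    zero    = x
  mat x y z w zero    (suc _) = y
  mat x y z w (suc _) zero    = z
  mat x y z w (suc _) (suc _) = w

  𝟏₂ : Mat₂ D̄
  𝟏₂ zero    zero    = 𝟏
  𝟏₂ zero    (suc _) = 0̄
  𝟏₂ (suc _) zero    = 0̄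
  𝟏₂ (suc _) (suc _) = 𝟏

  _≻ₘ_ : Mat₂ D̄ → Mat₂ Carrierᴹ → Mat₂ Carrierᴹ
  (P ≻ₘ Q) i j = (P i zero ≻̄ Q zero j) +ᴹ (P i (suc zero) ≻̄ Q (suc zero) j)

  Series : ∀ {a} → Set a → Set a
  Series A = ℕ → A

  infix 4 _≈ₛ_
  _≈ₛ_ : Series D̄ → Series D̄ → Set (ℓ ⊔ ℓm)
  X ≈ₛ Y = ∀ n → X n ≈̄ Y n

  _≈ₘₛ_ : Series (Mat₂ D̄) → Series (Mat₂ D̄) → Set (ℓ ⊔ ℓm)
  Z ≈ₘₛ W = ∀ n i j → Z n i j ≈̄ W n i j

  const : ∀ {a} {A : Set a} → A → A → Series A
  const z x zero    = x
  const z x (suc n) = z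

  λ· : ∀ {a} {A : Set a} → A → Series A → Series A
  λ· z S zero    = z
  λ· z S (suc n) = S n

  _+ₛ_ : Series D̄ → Series D̄ → Series D̄
  (X +ₛ Y) n = X n +̄ Y n

  _+ₘₛ_ : Series (Mat₂ D̄) → Series (Mat₂ D̄) → Series (Mat₂ D̄)
  (Z +ₘₛ W) n i j = Z n i j +̄ W n i j

  _≻ₛ_ : Series D̄ → Carrierᴹ → Series D̄
  (X ≻ₛ d) n = ι (X n ≻̄ d)

  _≻ₘₛ_ : Series (Mat₂ D̄) → Mat₂ Carrierᴹ → Series (Mat₂ D̄)
  (Z ≻ₘₛ M) n i j = ι ((Z n ≻ₘ M) i j)

  λ·ₛ : Series D̄ → Series D̄
  λ·ₛ = λ· 0̄

  λ·ₘₛ : Series (Mat₂ D̄) → Series (Mat₂ D̄)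
  λ·ₘₛ = λ· (λ _ _ → 0̄)

  𝟏ₛ : Series D̄
  𝟏ₛ = const 0̄ 𝟏

  𝟏₂ₛ : Series (Mat₂ D̄)
  𝟏₂ₛ = const (λ _ _ → 0̄) 𝟏₂

  entry : Series (Mat₂ D̄) → Fin 2 → Fin 2 → Series D̄
  entry Z i j n = Z n i j

-- Reading off the first row of Z = 1₂ + λ Z ≻ M entrywise gives
-- Z₁₂ = λ Z₁₁ ≻ b (the (2,2) entry of M is 0) and
-- Z₁₁ = 1 + λ Z₁₁ ≻ c + λ Z₁₂ ≻ a.  Substituting the first into the second
-- shows that Z₁₁ satisfies the defining recursion of X, and that recursion
-- has a unique solution because the coefficient of λⁿ on its right-hand side
-- only involves the coefficients of λⁿ⁻¹ and λⁿ⁻².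
module Submission where

open import Defs
open import Level using (Level)
open import Data.Nat using (zero; suc)
open import Data.Fin using (zero; suc)
open import Data.Product using (_×_; _,_; proj₁)
open import Relation.Binary.Bundles using (Setoid)
import Relation.Binary.Reasoning.Setoid as SetoidReasoning

module SeriesAlgebra {c ℓ m ℓm : Level} {k : Field c ℓ} (D : Dendriform k m ℓm) where
  open Aug D
  open Field k using (0#)
    renaming (refl to ≈-refl; sym to ≈-sym; trans to ≈-trans)
  open Dendriform D

  ≈̄-refl : ∀ {x} → x ≈̄ x
  ≈̄-refl = ≈-refl , ≈ᴹ-refl

  ≈̄-sym : ∀ {x y} → x ≈̄ y → y ≈̄ x
  ≈̄-sym (p , q) = ≈-sym p , ≈ᴹ-sym q

  ≈̄-trans : ∀ {x y z} → x ≈̄ y → y ≈̄ z → x ≈̄ z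
  ≈̄-trans (p , q) (p′ , q′) = ≈-trans p p′ , ≈ᴹ-trans q q′

  +̄-cong : ∀ {x x′ y y′} → x ≈̄ x′ → y ≈̄ y′ → x +̄ y ≈̄ x′ +̄ y′
  +̄-cong (p , q) (p′ , q′) = Field.+-cong k p p′ , +ᴹ-cong q q′

  +̄-identityˡ : ∀ x → 0̄ +̄ x ≈̄ x
  +̄-identityˡ x = Field.+-identityˡ k (scal x) , +ᴹ-identityˡ (vec x)

  +̄-identityʳ : ∀ x → x +̄ 0̄ ≈̄ x
  +̄-identityʳ x = Field.+-identityʳ k (scal x) , +ᴹ-identityʳ (vec x)

  ι-cong : ∀ {u v} → u ≈ᴹ v → ι u ≈̄ ι v
  ι-cong q = ≈-refl , q

  ι-+ : ∀ u v → ι (u +ᴹ v) ≈̄ ι u +̄ ι v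
  ι-+ u v = ≈-sym (Field.+-identityˡ k 0#) , ≈ᴹ-refl

  ≻̄-congˡ : ∀ {x y} d → x ≈̄ y → x ≻̄ d ≈ᴹ y ≻̄ d
  ≻̄-congˡ d (p , q) = +ᴹ-cong (*ₗ-cong p ≈ᴹ-refl) (≻-cong q ≈ᴹ-refl)

  ≻-zeroʳ : ∀ x → x ≻ 0ᴹ ≈ᴹ 0ᴹ
  ≻-zeroʳ x = begin
    x ≻ 0ᴹ          ≈⟨ ≻-cong ≈ᴹ-refl (≈ᴹ-sym (*ₗ-zeroˡ 0ᴹ)) ⟩
    x ≻ (0# *ₗ 0ᴹ)  ≈⟨ ≻-scalarʳ 0# x 0ᴹ ⟩
    0# *ₗ (x ≻ 0ᴹ)  ≈⟨ *ₗ-zeroˡ _ ⟩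
    0ᴹ              ∎
    where open SetoidReasoning ≈ᴹ-setoid

  ≻-zeroˡ : ∀ x → 0ᴹ ≻ x ≈ᴹ 0ᴹ
  ≻-zeroˡ x = begin
    0ᴹ ≻ x          ≈⟨ ≻-cong (≈ᴹ-sym (*ₗ-zeroˡ 0ᴹ)) ≈ᴹ-refl ⟩
    (0# *ₗ 0ᴹ) ≻ x  ≈⟨ ≻-scalarˡ 0# 0ᴹ x ⟩
    0# *ₗ (0ᴹ ≻ x)  ≈⟨ *ₗ-zeroˡ _ ⟩
    0ᴹ              ∎
    where open SetoidReasoning ≈ᴹ-setoid

  ≻̄-zeroʳ : ∀ x → x ≻̄ 0ᴹ ≈ᴹ 0ᴹ
  ≻̄-zeroʳ x = ≈ᴹ-trans (+ᴹ-cong (*ₗ-zeroʳ (scal x)) (≻-zeroʳ (vec x))) (+ᴹ-identityˡ 0ᴹ)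

  ≻̄-zeroˡ : ∀ d → 0̄ ≻̄ d ≈ᴹ 0ᴹ
  ≻̄-zeroˡ d = ≈ᴹ-trans (+ᴹ-cong (*ₗ-zeroˡ d) (≻-zeroˡ d)) (+ᴹ-identityˡ 0ᴹ)

  0ₛ : Series D̄
  0ₛ _ = 0̄

  seriesSetoid : Setoid (c Level.⊔ m) (ℓ Level.⊔ ℓm)
  seriesSetoid = record
    { Carrier       = Series D̄
    ; _≈_           = _≈ₛ_
    ; isEquivalence = record
      { refl  = λ n → ≈̄-refl
      ; sym   = λ p n → ≈̄-sym (p n)
      ; trans = λ p q n → ≈̄-trans (p n) (q n)
      }
    }

  +ₛ-cong : ∀ {X X′ Y Y′} → X ≈ₛ X′ → Y ≈ₛ Y′ → X +ₛ Y ≈ₛ X′ +ₛ Y′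
  +ₛ-cong p q n = +̄-cong (p n) (q n)

  +ₛ-identityˡ : ∀ X → 0ₛ +ₛ X ≈ₛ X
  +ₛ-identityˡ X n = +̄-identityˡ (X n)

  +ₛ-identityʳ : ∀ X → X +ₛ 0ₛ ≈ₛ X
  +ₛ-identityʳ X n = +̄-identityʳ (X n)

  ≻ₛ-congˡ : ∀ {X Y} d → X ≈ₛ Y → X ≻ₛ d ≈ₛ Y ≻ₛ d
  ≻ₛ-congˡ d p n = ι-cong (≻̄-congˡ d (p n))

  ≻ₛ-zeroʳ : ∀ X → X ≻ₛ 0ᴹ ≈ₛ 0ₛ
  ≻ₛ-zeroʳ X n = ι-cong (≻̄-zeroʳ (X n))

  λ·ₛ-cong : ∀ {X Y} → X ≈ₛ Y → λ·ₛ X ≈ₛ λ·ₛ Y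
  λ·ₛ-cong p zero    = ≈̄-refl
  λ·ₛ-cong p (suc n) = p n

  λ·ₛ-+ₛ : ∀ X Y → λ·ₛ (X +ₛ Y) ≈ₛ λ·ₛ X +ₛ λ·ₛ Y
  λ·ₛ-+ₛ X Y zero    = ≈̄-sym (+̄-identityˡ 0̄)
  λ·ₛ-+ₛ X Y (suc n) = ≈̄-refl

  λ·ₛ-≻ₛ : ∀ X d → λ·ₛ (X ≻ₛ d) ≈ₛ λ·ₛ X ≻ₛ d
  λ·ₛ-≻ₛ X d zero    = ι-cong (≈ᴹ-sym (≻̄-zeroˡ d))
  λ·ₛ-≻ₛ X d (suc n) = ≈̄-refl

  entry-cong : ∀ {Z W} → Z ≈ₘₛ W → ∀ i j → entry Z i j ≈ₛ entry W i j
  entry-cong p i j n = p n i j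

  entry-𝟏₂ₛ-diag : ∀ i → entry 𝟏₂ₛ i i ≈ₛ 𝟏ₛ
  entry-𝟏₂ₛ-diag zero    zero    = ≈̄-refl
  entry-𝟏₂ₛ-diag (suc _) zero    = ≈̄-refl
  entry-𝟏₂ₛ-diag zero    (suc n) = ≈̄-refl
  entry-𝟏₂ₛ-diag (suc _) (suc n) = ≈̄-refl

  entry-𝟏₂ₛ-offdiag : entry 𝟏₂ₛ zero (suc zero) ≈ₛ 0ₛ
  entry-𝟏₂ₛ-offdiag zero    = ≈̄-refl
  entry-𝟏₂ₛ-offdiag (suc n) = ≈̄-refl

  entry-λ·ₘₛ : ∀ Z i j → entry (λ·ₘₛ Z) i j ≈ₛ λ·ₛ (entry Z i j)
  entry-λ·ₘₛ Z i j zero    = ≈̄-refl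
  entry-λ·ₘₛ Z i j (suc n) = ≈̄-refl

  entry-≻ₘₛ : ∀ Z M i j →
    entry (Z ≻ₘₛ M) i j
      ≈ₛ (entry Z i zero ≻ₛ M zero j) +ₛ (entry Z i (suc zero) ≻ₛ M (suc zero) j)
  entry-≻ₘₛ Z M i j n = ι-+ _ _

module FirstRow {c ℓ m ℓm : Level} {k : Field c ℓ} (D : Dendriform k m ℓm)
                (a b c : Dendriform.Carrierᴹ D) where
  open Aug D
  open Dendriform D using (0ᴹ)
  open SeriesAlgebra D
  open Setoid seriesSetoid using () renaming (refl to ≈ₛ-refl; sym to ≈ₛ-sym; trans to ≈ₛ-trans)
  open SetoidReasoning seriesSetoid

  M : Mat₂ (Dendriform.Carrierᴹ D)
  M = mat c b a 0ᴹ

  xRecursion : Series D̄ → Series D̄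
  xRecursion X = 𝟏ₛ +ₛ (λ·ₛ (X ≻ₛ c) +ₛ λ·ₛ (λ·ₛ ((X ≻ₛ b) ≻ₛ a)))

  xRecursion-unique : ∀ {X Y} → X ≈ₛ xRecursion X → Y ≈ₛ xRecursion Y → X ≈ₛ Y
  xRecursion-unique {X} {Y} hX hY n = proj₁ (agree n)
    where
    fromRecursion : ∀ n → xRecursion X n ≈̄ xRecursion Y n → X n ≈̄ Y n
    fromRecursion n p = ≈̄-trans (hX n) (≈̄-trans p (≈̄-sym (hY n)))

    agree : ∀ n → X n ≈̄ Y n × X (suc n) ≈̄ Y (suc n)
    agree zero = x₀ , fromRecursion 1 (+̄-cong ≈̄-refl (+̄-cong (ι-cong (≻̄-congˡ c x₀)) ≈̄-refl))
      where
      x₀ : X 0 ≈̄ Y 0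
      x₀ = fromRecursion 0 ≈̄-refl
    agree (suc n) with agree n
    ... | xₙ , xₙ₊₁ =
      xₙ₊₁ , fromRecursion (suc (suc n))
        (+̄-cong ≈̄-refl (+̄-cong (ι-cong (≻̄-congˡ c xₙ₊₁))
                                 (ι-cong (≻̄-congˡ a (ι-cong (≻̄-congˡ b xₙ))))))

  module _ {Z : Series (Mat₂ D̄)} (hZ : Z ≈ₘₛ (𝟏₂ₛ +ₘₛ λ·ₘₛ (Z ≻ₘₛ M))) where

    firstRow : ∀ j → entry Z zero j
      ≈ₛ entry 𝟏₂ₛ zero j
           +ₛ λ·ₛ ((entry Z zero zero ≻ₛ M zero j)
                     +ₛ (entry Z zero (suc zero) ≻ₛ M (suc zero) j))
    firstRow j =
      ≈ₛ-trans (entry-cong hZ zero j)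
        (+ₛ-cong ≈ₛ-refl
          (≈ₛ-trans (entry-λ·ₘₛ (Z ≻ₘₛ M) zero j) (λ·ₛ-cong (entry-≻ₘₛ Z M zero j))))

    Z₁₂≈λ·Z₁₁≻b : entry Z zero (suc zero) ≈ₛ λ·ₛ (entry Z zero zero ≻ₛ b)
    Z₁₂≈λ·Z₁₁≻b = begin
      entry Z zero (suc zero)                                       ≈⟨ firstRow (suc zero) ⟩
      entry 𝟏₂ₛ zero (suc zero)
        +ₛ λ·ₛ ((entry Z zero zero ≻ₛ b) +ₛ (entry Z zero (suc zero) ≻ₛ 0ᴹ))
                                                                    ≈⟨ +ₛ-cong entry-𝟏₂ₛ-offdiag
                                                                         (λ·ₛ-cong (+ₛ-cong ≈ₛ-refl (≻ₛ-zeroʳ _))) ⟩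
      0ₛ +ₛ λ·ₛ ((entry Z zero zero ≻ₛ b) +ₛ 0ₛ)                    ≈⟨ +ₛ-identityˡ _ ⟩
      λ·ₛ ((entry Z zero zero ≻ₛ b) +ₛ 0ₛ)                          ≈⟨ λ·ₛ-cong (+ₛ-identityʳ _) ⟩
      λ·ₛ (entry Z zero zero ≻ₛ b)                                  ∎

    Z₁₁-solves-xRecursion : entry Z zero zero ≈ₛ xRecursion (entry Z zero zero)
    Z₁₁-solves-xRecursion = begin
      Z₁₁                                                   ≈⟨ firstRow zero ⟩
      entry 𝟏₂ₛ zero zero +ₛ λ·ₛ ((Z₁₁ ≻ₛ c) +ₛ (Z₁₂ ≻ₛ a))  ≈⟨ +ₛ-cong (entry-𝟏₂ₛ-diag zero) (λ·ₛ-+ₛ _ _) ⟩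
      𝟏ₛ +ₛ (λ·ₛ (Z₁₁ ≻ₛ c) +ₛ λ·ₛ (Z₁₂ ≻ₛ a))               ≈⟨ +ₛ-cong ≈ₛ-refl
                                                                  (+ₛ-cong ≈ₛ-refl substitute) ⟩
      xRecursion Z₁₁                                        ∎
      where
      Z₁₁ Z₁₂ : Series D̄
      Z₁₁ = entry Z zero zero
      Z₁₂ = entry Z zero (suc zero)
      substitute : λ·ₛ (Z₁₂ ≻ₛ a) ≈ₛ λ·ₛ (λ·ₛ ((Z₁₁ ≻ₛ b) ≻ₛ a))
      substitute = λ·ₛ-cong (≈ₛ-trans (≻ₛ-congˡ a Z₁₂≈λ·Z₁₁≻b) (≈ₛ-sym (λ·ₛ-≻ₛ _ a)))

-- Characteristic zero is only needed for exp* and log*, which do not enter here.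
mainTheorem8 : ∀ {c ℓ m ℓm : Level} (k : Field c ℓ) → CharacteristicZero k →
    (D : Dendriform k m ℓm) →
    let open Aug D in
    (a b c : Dendriform.Carrierᴹ D) (Z : Series (Mat₂ D̄)) (X : Series D̄) →
    Z ≈ₘₛ (𝟏₂ₛ +ₘₛ λ·ₘₛ (Z ≻ₘₛ mat c b a (Dendriform.0ᴹ D))) →
    X ≈ₛ (𝟏ₛ +ₛ (λ·ₛ (X ≻ₛ c) +ₛ λ·ₛ (λ·ₛ ((X ≻ₛ b) ≻ₛ a)))) →
    (entry Z zero zero ≈ₛ X) × (entry Z zero (suc zero) ≈ₛ λ·ₛ (X ≻ₛ b))
mainTheorem8 k _ D a b c Z X hZ hX =
  Z₁₁≈X , ≈ₛ-trans (Z₁₂≈λ·Z₁₁≻b hZ) (λ·ₛ-cong (≻ₛ-congˡ b Z₁₁≈X))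
  where
  open SeriesAlgebra D
  open Setoid seriesSetoid using () renaming (trans to ≈ₛ-trans)
  open FirstRow D a b c
  open Aug D
  Z₁₁≈X : entry Z zero zero ≈ₛ X
  Z₁₁≈X = xRecursion-unique (Z₁₁-solves-xRecursion hZ) hX
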